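{- For every integer $n\ge1$, $3\nmid D_S(n)$.
   Context: The Salajan sequence is $u_1,u_2,\ldots$ with $u_j=(3^j-5(-1)^j)/4$ for $j\ge1$; its terms are distinct. For $n\ge1$, $D_S(n)$ is the smallest positive integer $m$ such that $u_1,\ldots,u_n$ are pairwise incongruent modulo $m$. -}

module Defs where

open import Data.Nat as ℕ using (ℕ; suc; _<_; _≤_; NonZero)
open import Data.Integer as ℤ using (ℤ; +_; -_; _-_; _*_; _^_)
open import Data.Integer.DivMod using (_/ℕ_)
open import Data.Integer.Divisibility using (_∣_)
open import Relation.Nullary using (¬_)
open import Data.Product using (_×_)
open import Relation.Binary.PropositionalEquality using (_≢_)

-1^ : ℕ → ℤ
-1^ j = (- + 1) ^ j

-- Salajan sequence: u j = (3^j - 5 (-1)^j) / 4  (exact division), for j ≥ 1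
u : ℕ → ℤ
u j = ((+ 3) ^ j - (+ 5) * -1^ j) /ℕ 4

PairwiseIncongruent : ℕ → ℕ → Set
PairwiseIncongruent n m =
  ∀ i j → 1 ≤ i → i ≤ n → 1 ≤ j → j ≤ n → i ≢ j → ¬ ((+ m) ∣ (u i - u j))

IsDS : ℕ → ℕ → Set
IsDS n m = (1 ≤ m × PairwiseIncongruent n m)
         × (∀ k → 1 ≤ k → k < m → ¬ PairwiseIncongruent n k)

{-# OPTIONS --safe #-}
module Submission where

-- Suppose 3 ∣ m and m separates u₁, …, uₙ; we exhibit a smaller separating modulus.
-- For indices i and i + 2k the difference is u_{i+2k} − u_i = 3^i (9^k − 1)/4, whose
-- 2-adic valuation is that of 2k, while terms at indices of opposite parity have opposite
-- parity. Hence every power of two 2^e ≥ n separates u₁, …, uₙ, and a difference divisible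
-- by 2 is divisible by 3 (by 9 if both indices are at least 2).
-- If m = 3K with 3 ∤ K, then 2K separates as well: a difference divisible by 2K is divisible
-- by 3K. If m = 9Q, then u₂, …, uₙ lie in at most 2Q residue classes mod 9Q (a class is fixed
-- by the parity and the quotient by 9), so n ≤ 2Q + 1 and the power of two in [n, 2n) is < m.

open import Defs
open import Data.Nat using (ℕ; _≤_)
open import Data.Nat.Divisibility using (_∣_)
open import Relation.Nullary using (¬_)

open import Data.Fin using (Fin; toℕ; fromℕ<; combine)
open import Data.Fin.Properties
  using (pigeonhole; toℕ≤pred[n]; toℕ-injective; fromℕ<-injective; combine-injective)
import Data.Fin.Properties as Fin
import Data.Integer as ℤ
import Data.Integer.Properties as ℤ
open import Data.Nat.Base
  using (zero; suc; _+_; _*_; _∸_; _^_; _<_; _⊓_; ∣_-_∣; _%_; _/_; NonZero; >-nonZero; z≤n; s≤s)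
open import Data.Nat.DivMod
  using ([m+n]%n≡m%n; [m+kn]%n≡m%n; m≡m%n+[m/n]*n; m%n<n; m*n/n≡m; m<n*o⇒m/o<n; m∣n⇒o%n%m≡o%m)
open import Data.Nat.Divisibility
  using (_∤_; _∣?_; divides; ∣-trans; >⇒∤; 1∣_; m∣m*n; n∣m*n; *-monoʳ-∣; *-cancelˡ-∣; n∣m⇒m%n≡0)
open import Data.Nat.Primality using (Prime; prime[2]; prime⇒nonZero; prime?; euclidsLemma)
open import Data.Nat.Properties
open import Data.Nat.Tactic.RingSolver using (solve-∀)
open import Data.Product using (∃-syntax; _×_; _,_; proj₁; proj₂)
open import Data.Sum using (_⊎_; inj₁; inj₂)
open import Function using (_∘_)
open import Relation.Binary.Consequences using (wlog)
open import Relation.Binary.PropositionalEquality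
open import Relation.Nullary using (yes; no; contradiction)
open import Relation.Nullary.Decidable using (from-yes)

data Parity : ℕ → Set where
  even : ∀ k → Parity (2 * k)
  odd  : ∀ k → Parity (1 + 2 * k)

parity : ∀ n → Parity n
parity zero = even 0
parity (suc n) with parity n
... | even k = odd k
... | odd k  = subst Parity (*-distribˡ-+ 2 1 k) (even (suc k))

2*n%2≡0 : ∀ n → 2 * n % 2 ≡ 0
2*n%2≡0 n = trans (cong (_% 2) (*-comm 2 n)) ([m+kn]%n≡m%n 0 n 2)

[1+2*n]%2≡1 : ∀ n → (1 + 2 * n) % 2 ≡ 1
[1+2*n]%2≡1 n = trans (cong (λ x → (1 + x) % 2) (*-comm 2 n)) ([m+kn]%n≡m%n 1 n 2)

n%2≢[1+n]%2 : ∀ n → n % 2 ≢ suc n % 2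
n%2≢[1+n]%2 zero          ()
n%2≢[1+n]%2 (suc zero)    ()
n%2≢[1+n]%2 (suc (suc n)) eq = n%2≢[1+n]%2 n (trans (sym ([2+n]%2≡n%2 n)) (trans eq ([2+n]%2≡n%2 (suc n))))
  where
  [2+n]%2≡n%2 : ∀ n → (2 + n) % 2 ≡ n % 2
  [2+n]%2≡n%2 n = trans (cong (_% 2) (+-comm 2 n)) ([m+n]%n≡m%n n 2)

%2≡1⇒2∤ : ∀ {n} → n % 2 ≡ 1 → 2 ∤ n
%2≡1⇒2∤ {n} n%2≡1 2∣n = 0≢1+n (trans (sym (n∣m⇒m%n≡0 n 2 2∣n)) n%2≡1)

∣∸⇒%≡% : ∀ d {a b} .{{_ : NonZero d}} → a ≤ b → d ∣ b ∸ a → b % d ≡ a % d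
∣∸⇒%≡% d {a} {b} a≤b (divides q b∸a≡q*d) = begin
  b % d             ≡⟨ cong (_% d) (m+[n∸m]≡n a≤b) ⟨
  (a + (b ∸ a)) % d ≡⟨ cong (λ x → (a + x) % d) b∸a≡q*d ⟩
  (a + q * d) % d   ≡⟨ [m+kn]%n≡m%n a q d ⟩
  a % d             ∎
  where open ≡-Reasoning

∣∣-∣⇒%≡% : ∀ d {a b} .{{_ : NonZero d}} → d ∣ ∣ a - b ∣ → a % d ≡ b % d
∣∣-∣⇒%≡% d {a} {b} d∣∣a-b∣ with ≤-total a b
... | inj₁ a≤b = sym (∣∸⇒%≡% d a≤b (subst (d ∣_) (m≤n⇒∣m-n∣≡n∸m a≤b) d∣∣a-b∣))
... | inj₂ b≤a = ∣∸⇒%≡% d b≤a (subst (d ∣_) (m≤n⇒∣n-m∣≡n∸m b≤a) d∣∣a-b∣)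

%≡%⇒∣∣-∣ : ∀ d {a b} .{{_ : NonZero d}} → a % d ≡ b % d → d ∣ ∣ a - b ∣
%≡%⇒∣∣-∣ d {a} {b} a%d≡b%d = divides ∣ a / d - b / d ∣ (begin
  ∣ a - b ∣                                    ≡⟨ cong₂ ∣_-_∣ (m≡m%n+[m/n]*n a d) (m≡m%n+[m/n]*n b d) ⟩
  ∣ a % d + a / d * d - (b % d + b / d * d) ∣ ≡⟨ cong (λ r → ∣ r + a / d * d - (b % d + b / d * d) ∣) a%d≡b%d ⟩
  ∣ b % d + a / d * d - (b % d + b / d * d) ∣ ≡⟨ ∣m+n-m+o∣≡∣n-o∣ (b % d) _ _ ⟩
  ∣ a / d * d - b / d * d ∣                    ≡⟨ *-distribʳ-∣-∣ d (a / d) (b / d) ⟨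
  ∣ a / d - b / d ∣ * d                        ∎)
  where open ≡-Reasoning

%≡%∧/≡/⇒≡ : ∀ d {a b} .{{_ : NonZero d}} → a % d ≡ b % d → a / d ≡ b / d → a ≡ b
%≡%∧/≡/⇒≡ d {a} {b} a%d≡b%d a/d≡b/d = begin
  a                  ≡⟨ m≡m%n+[m/n]*n a d ⟩
  a % d + a / d * d  ≡⟨ cong₂ (λ r q → r + q * d) a%d≡b%d a/d≡b/d ⟩
  b % d + b / d * d  ≡⟨ m≡m%n+[m/n]*n b d ⟨
  b                  ∎
  where open ≡-Reasoning

∣∣m-n∣⇒≡ : ∀ {d m n} → ∣ m - n ∣ < d → d ∣ ∣ m - n ∣ → m ≡ n
∣∣m-n∣⇒≡ {d} {m} {n} ∣m-n∣<d d∣∣m-n∣ with ∣ m - n ∣ in eq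
... | zero  = ∣m-n∣≡0⇒m≡n eq
... | suc _ = contradiction d∣∣m-n∣ (>⇒∤ ∣m-n∣<d)

prime[3] : Prime 3
prime[3] = from-yes (prime? 3)

p^e∣m*n∧p∤n⇒p^e∣m : ∀ {p} e {m n} → Prime p → p ^ e ∣ m * n → p ∤ n → p ^ e ∣ m
p^e∣m*n∧p∤n⇒p^e∣m zero {m} _ _ _ = 1∣ m
p^e∣m*n∧p∤n⇒p^e∣m {p} (suc e) {m} {n} pp p^[1+e]∣m*n p∤n
  with euclidsLemma m n pp (∣-trans (m∣m*n (p ^ e)) p^[1+e]∣m*n)
... | inj₂ p∣n = contradiction p∣n p∤n
... | inj₁ (divides q refl) = subst (p ^ suc e ∣_) (*-comm p q) (*-monoʳ-∣ p p^e∣q)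
  where
  instance
    p≢0 : NonZero p
    p≢0 = prime⇒nonZero pp
  lemma : ∀ q p n → q * p * n ≡ p * (q * n)
  lemma = solve-∀
  p^e∣q : p ^ e ∣ q
  p^e∣q = p^e∣m*n∧p∤n⇒p^e∣m e pp (*-cancelˡ-∣ p (subst (p ^ suc e ∣_) (lemma q p n) p^[1+e]∣m*n)) p∤n

p∤k∧k∣m∧p∣m⇒k*p∣m : ∀ {p k m} → Prime p → p ∤ k → k ∣ m → p ∣ m → k * p ∣ m
p∤k∧k∣m∧p∣m⇒k*p∣m {p} {k} pp p∤k (divides q refl) p∣q*k with euclidsLemma q k pp p∣q*k
... | inj₂ p∣k = contradiction p∣k p∤k
... | inj₁ (divides r refl) = divides r (lemma r p k)
  where
  lemma : ∀ r p k → r * p * k ≡ r * (k * p)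
  lemma = solve-∀

2∤3^n : ∀ n → 2 ∤ 3 ^ n
2∤3^n zero    = %2≡1⇒2∤ refl
2∤3^n (suc n) 2∣3^[1+n] with euclidsLemma 3 (3 ^ n) prime[2] 2∣3^[1+n]
... | inj₁ 2∣3   = %2≡1⇒2∤ refl 2∣3
... | inj₂ 2∣3^n = 2∤3^n n 2∣3^n

9∣3^[2+n] : ∀ n → 9 ∣ 3 ^ (2 + n)
9∣3^[2+n] n = divides (3 ^ n) (lemma (3 ^ n))
  where
  lemma : ∀ p → 3 * (3 * p) ≡ p * 9
  lemma = solve-∀

2^-between : ∀ n → ∃[ e ] suc n ≤ 2 ^ e × 2 ^ e < 2 * suc n
2^-between zero = 0 , s≤s z≤n , s≤s (s≤s z≤n)
2^-between (suc n) with 2^-between n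
... | e , 1+n≤2^e , 2^e<2+2n with 2 + n ≤? 2 ^ e
...   | yes 2+n≤2^e = e , 2+n≤2^e , <-≤-trans 2^e<2+2n (*-monoʳ-≤ 2 (n≤1+n (suc n)))
...   | no 2+n≰2^e =
  let 2^e≡1+n = ≤-antisym (≤-pred (≰⇒> 2+n≰2^e)) 1+n≤2^e
  in suc e
   , subst (λ x → 2 + n ≤ 2 * x) (sym 2^e≡1+n)
       (subst (2 + n ≤_) (sym (*-distribˡ-+ 2 1 n)) (+-monoʳ-≤ 2 (m≤n*m n 2)))
   , subst (λ x → 2 * x < 2 * (2 + n)) (sym 2^e≡1+n) (*-monoʳ-< 2 (n<1+n (suc n)))

-- The 2-adic valuation of (9^k − 1)/8 is that of k

repunit₉ : ℕ → ℕ
repunit₉ zero    = 0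
repunit₉ (suc k) = 1 + 9 * repunit₉ k

9^k≡8*repunit₉+1 : ∀ k → 9 ^ k ≡ 8 * repunit₉ k + 1
9^k≡8*repunit₉+1 zero    = refl
9^k≡8*repunit₉+1 (suc k) rewrite 9^k≡8*repunit₉+1 k = lemma (repunit₉ k)
  where
  lemma : ∀ r → 9 * (8 * r + 1) ≡ 8 * (1 + 9 * r) + 1
  lemma = solve-∀

repunit₉-+ : ∀ r k → repunit₉ (r + k) ≡ repunit₉ r + 9 ^ r * repunit₉ k
repunit₉-+ zero    k = sym (+-identityʳ (repunit₉ k))
repunit₉-+ (suc r) k rewrite repunit₉-+ r k = lemma (repunit₉ r) (9 ^ r) (repunit₉ k)
  where
  lemma : ∀ a b c → 1 + 9 * (a + b * c) ≡ 1 + 9 * a + 9 * b * c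
  lemma = solve-∀

repunit₉[2*k] : ∀ k → repunit₉ (2 * k) ≡ 2 * (repunit₉ k * (1 + 2 * (2 * repunit₉ k)))
repunit₉[2*k] k = begin
  repunit₉ (2 * k)                                ≡⟨ cong repunit₉ (cong (k +_) (+-identityʳ k)) ⟩
  repunit₉ (k + k)                                ≡⟨ repunit₉-+ k k ⟩
  repunit₉ k + 9 ^ k * repunit₉ k                 ≡⟨ cong (λ x → repunit₉ k + x * repunit₉ k) (9^k≡8*repunit₉+1 k) ⟩
  repunit₉ k + (8 * repunit₉ k + 1) * repunit₉ k  ≡⟨ lemma (repunit₉ k) ⟩
  2 * (repunit₉ k * (1 + 2 * (2 * repunit₉ k)))   ∎
  where
  open ≡-Reasoning
  lemma : ∀ r → r + (8 * r + 1) * r ≡ 2 * (r * (1 + 2 * (2 * r)))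
  lemma = solve-∀

repunit₉[1+2*k]%2≡1 : ∀ k → repunit₉ (1 + 2 * k) % 2 ≡ 1
repunit₉[1+2*k]%2≡1 k = begin
  (1 + 9 * repunit₉ (2 * k)) % 2   ≡⟨ cong (λ x → (1 + 9 * x) % 2) (repunit₉[2*k] k) ⟩
  (1 + 9 * (2 * r)) % 2            ≡⟨ cong (λ x → (1 + x) % 2) (lemma r) ⟩
  (1 + 2 * (9 * r)) % 2            ≡⟨ [1+2*n]%2≡1 (9 * r) ⟩
  1                                ∎
  where
  open ≡-Reasoning
  r : ℕ
  r = repunit₉ k * (1 + 2 * (2 * repunit₉ k))
  lemma : ∀ r → 9 * (2 * r) ≡ 2 * (9 * r)
  lemma = solve-∀

2^e∣repunit₉⇒2^e∣ : ∀ e k → 2 ^ e ∣ repunit₉ k → 2 ^ e ∣ k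
2^e∣repunit₉⇒2^e∣ zero    k _ = 1∣ k
2^e∣repunit₉⇒2^e∣ (suc e) k 2^[1+e]∣r with parity k
... | odd t  = contradiction (∣-trans (m∣m*n (2 ^ e)) 2^[1+e]∣r) (%2≡1⇒2∤ (repunit₉[1+2*k]%2≡1 t))
... | even t = *-monoʳ-∣ 2 (2^e∣repunit₉⇒2^e∣ e t 2^e∣r)
  where
  2^e∣r : 2 ^ e ∣ repunit₉ t
  2^e∣r = p^e∣m*n∧p∤n⇒p^e∣m e prime[2]
    (*-cancelˡ-∣ 2 (subst (2 ^ suc e ∣_) (repunit₉[2*k] t) 2^[1+e]∣r))
    (%2≡1⇒2∤ ([1+2*n]%2≡1 (2 * repunit₉ t)))

-- Separating moduli

Separated : (ℕ → ℕ) → ℕ → ℕ → Set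
Separated f n m = ∀ i j → i < n → j < n → i ≢ j → m ∤ ∣ f i - f j ∣

separated-length-bound : ∀ {f n m} a k (class : ℕ → Fin k) →
  (∀ i j → a ≤ i → a ≤ j → class i ≡ class j → m ∣ ∣ f i - f j ∣) →
  Separated f n m → n ≤ a + k
separated-length-bound {n = n} a k class collide separated = ≮⇒≥ too-long
  where
  index : Fin (suc k) → ℕ
  index x = a + toℕ x

  index<n : a + k < n → ∀ x → index x < n
  index<n a+k<n x = ≤-trans (s≤s (+-monoʳ-≤ a (toℕ≤pred[n] x))) a+k<n

  index-injective : ∀ {x y} → index x ≡ index y → x ≡ y
  index-injective eq = toℕ-injective (+-cancelˡ-≡ a _ _ eq)

  too-long : ¬ a + k < n
  too-long a+k<n with pigeonhole (n<1+n k) (class ∘ index)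
  ... | x , y , x<y , cx≡cy =
    separated (index x) (index y) (index<n a+k<n x) (index<n a+k<n y) (Fin.<⇒≢ x<y ∘ index-injective)
      (collide (index x) (index y) (m≤m+n a (toℕ x)) (m≤m+n a (toℕ y)) cx≡cy)

-- The sequence as natural numbers

+m^n≡+[m^n] : ∀ m n → (ℤ.+ m) ℤ.^ n ≡ ℤ.+ (m ^ n)
+m^n≡+[m^n] m zero    = refl
+m^n≡+[m^n] m (suc n) = trans (cong (ℤ.+ m ℤ.*_) (+m^n≡+[m^n] m n)) (sym (ℤ.pos-* m (m ^ n)))

∣+m-+n∣≡∣m-n∣ : ∀ m n → ℤ.∣ ℤ.+ m ℤ.- ℤ.+ n ∣ ≡ ∣ m - n ∣
∣+m-+n∣≡∣m-n∣ m n with ≤-total m n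
... | inj₁ m≤n = begin
  ℤ.∣ ℤ.+ m ℤ.- ℤ.+ n ∣ ≡⟨ cong ℤ.∣_∣ (ℤ.[+m]-[+n]≡m⊖n m n) ⟩
  ℤ.∣ m ℤ.⊖ n ∣         ≡⟨ ℤ.∣⊖∣-≤ m≤n ⟩
  n ∸ m                 ≡⟨ m≤n⇒∣m-n∣≡n∸m m≤n ⟨
  ∣ m - n ∣             ∎
  where open ≡-Reasoning
... | inj₂ n≤m = begin
  ℤ.∣ ℤ.+ m ℤ.- ℤ.+ n ∣ ≡⟨ cong ℤ.∣_∣ (ℤ.[+m]-[+n]≡m⊖n m n) ⟩
  ℤ.∣ m ℤ.⊖ n ∣         ≡⟨ ℤ.∣m⊖n∣≡∣n⊖m∣ m n ⟩
  ℤ.∣ n ℤ.⊖ m ∣         ≡⟨ ℤ.∣⊖∣-≤ n≤m ⟩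
  m ∸ n                 ≡⟨ m≤n⇒∣n-m∣≡n∸m n≤m ⟨
  ∣ m - n ∣             ∎
  where open ≡-Reasoning

-1^[2*k]≡1 : ∀ k → -1^ (2 * k) ≡ ℤ.+ 1
-1^[2*k]≡1 k = trans (sym (ℤ.^-*-assoc (ℤ.- ℤ.+ 1) 2 k)) (ℤ.^-zeroˡ k)

3^[2*k]≡8*repunit₉+1 : ∀ k → 3 ^ (2 * k) ≡ 8 * repunit₉ k + 1
3^[2*k]≡8*repunit₉+1 k = trans (sym (^-*-assoc 3 2 k)) (9^k≡8*repunit₉+1 k)

u[1+2*k] : ∀ k → u (1 + 2 * k) ≡ ℤ.+ (2 + 6 * repunit₉ k)
u[1+2*k] k = begin
  u (1 + 2 * k)                    ≡⟨ cong₂ (λ a b → (a ℤ.- ℤ.+ 5 ℤ.* (ℤ.- ℤ.+ 1 ℤ.* b)) ℤ./ℕ 4)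
                                            (+m^n≡+[m^n] 3 (1 + 2 * k)) (-1^[2*k]≡1 k) ⟩
  ℤ.+ ((3 * 3 ^ (2 * k) + 5) / 4)  ≡⟨ cong (λ x → ℤ.+ ((3 * x + 5) / 4)) (3^[2*k]≡8*repunit₉+1 k) ⟩
  ℤ.+ ((3 * (8 * r + 1) + 5) / 4)  ≡⟨ cong (λ x → ℤ.+ (x / 4)) (lemma r) ⟩
  ℤ.+ ((2 + 6 * r) * 4 / 4)        ≡⟨ cong ℤ.+_ (m*n/n≡m (2 + 6 * r) 4) ⟩
  ℤ.+ (2 + 6 * r)                  ∎
  where
  open ≡-Reasoning
  r : ℕ
  r = repunit₉ k
  lemma : ∀ r → 3 * (8 * r + 1) + 5 ≡ (2 + 6 * r) * 4
  lemma = solve-∀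

u[2+2*k] : ∀ k → u (2 + 2 * k) ≡ ℤ.+ (1 + 18 * repunit₉ k)
u[2+2*k] k = begin
  u (2 + 2 * k)                                   ≡⟨ cong₂ (λ a b → (a ℤ.- ℤ.+ 5 ℤ.* (ℤ.- ℤ.+ 1 ℤ.* (ℤ.- ℤ.+ 1 ℤ.* b))) ℤ./ℕ 4)
                                                           (+m^n≡+[m^n] 3 (2 + 2 * k)) (-1^[2*k]≡1 k) ⟩
  (ℤ.+ (3 * (3 * 3 ^ (2 * k))) ℤ.- ℤ.+ 5) ℤ./ℕ 4  ≡⟨ cong (λ x → (ℤ.+ (3 * (3 * x)) ℤ.- ℤ.+ 5) ℤ./ℕ 4) (3^[2*k]≡8*repunit₉+1 k) ⟩
  (ℤ.+ (3 * (3 * (8 * r + 1))) ℤ.- ℤ.+ 5) ℤ./ℕ 4  ≡⟨ cong (λ x → (ℤ.+ x ℤ.- ℤ.+ 5) ℤ./ℕ 4) (lemma r) ⟩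
  ℤ.+ ((1 + 18 * r) * 4 / 4)                      ≡⟨ cong ℤ.+_ (m*n/n≡m (1 + 18 * r) 4) ⟩
  ℤ.+ (1 + 18 * r)                                ∎
  where
  open ≡-Reasoning
  r : ℕ
  r = repunit₉ k
  lemma : ∀ r → 3 * (3 * (8 * r + 1)) ≡ 5 + (1 + 18 * r) * 4
  lemma = solve-∀

-- Opaque: letting the type checker unfold u in conversion problems exhausts memory.
opaque
  v : ℕ → ℕ
  v i = ℤ.∣ u (suc i) ∣

  u≡+v : ∀ i → u (suc i) ≡ ℤ.+ v i
  u≡+v i with parity i
  ... | even k = trans (u[1+2*k] k) (cong (ℤ.+_ ∘ ℤ.∣_∣) (sym (u[1+2*k] k)))
  ... | odd k  = trans (u[2+2*k] k) (cong (ℤ.+_ ∘ ℤ.∣_∣) (sym (u[2+2*k] k)))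

  v[2*k] : ∀ k → v (2 * k) ≡ 2 + 6 * repunit₉ k
  v[2*k] k = cong ℤ.∣_∣ (u[1+2*k] k)

  v[1+2*k] : ∀ k → v (1 + 2 * k) ≡ 1 + 18 * repunit₉ k
  v[1+2*k] k = cong ℤ.∣_∣ (u[2+2*k] k)

∣u-u∣≡∣v-v∣ : ∀ i j → ℤ.∣ u (suc i) ℤ.- u (suc j) ∣ ≡ ∣ v i - v j ∣
∣u-u∣≡∣v-v∣ i j = trans (cong₂ (λ a b → ℤ.∣ a ℤ.- b ∣) (u≡+v i) (u≡+v j)) (∣+m-+n∣≡∣m-n∣ (v i) (v j))

incongruent⇒separated : ∀ {n m} → PairwiseIncongruent n m → Separated v n m
incongruent⇒separated {m = m} incongruent i j i<n j<n i≢j m∣ =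
  incongruent (suc i) (suc j) (s≤s z≤n) i<n (s≤s z≤n) j<n (i≢j ∘ suc-injective)
    (subst (m ∣_) (sym (∣u-u∣≡∣v-v∣ i j)) m∣)

separated⇒incongruent : ∀ {n m} → Separated v n m → PairwiseIncongruent n m
separated⇒incongruent {m = m} separated (suc i) (suc j) _ i<n _ j<n 1+i≢1+j m∣ =
  separated i j i<n j<n (1+i≢1+j ∘ cong suc) (subst (m ∣_) (∣u-u∣≡∣v-v∣ i j) m∣)

v%2≡%2 : ∀ i → v i % 2 ≡ i % 2
v%2≡%2 i with parity i
... | even k = begin
  v (2 * k) % 2                   ≡⟨ cong (_% 2) (trans (v[2*k] k) (lemma (repunit₉ k))) ⟩
  2 * (1 + 3 * repunit₉ k) % 2    ≡⟨ 2*n%2≡0 (1 + 3 * repunit₉ k) ⟩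
  0                               ≡⟨ 2*n%2≡0 k ⟨
  2 * k % 2                       ∎
  where
  open ≡-Reasoning
  lemma : ∀ r → 2 + 6 * r ≡ 2 * (1 + 3 * r)
  lemma = solve-∀
... | odd k = begin
  v (1 + 2 * k) % 2               ≡⟨ cong (_% 2) (trans (v[1+2*k] k) (lemma (repunit₉ k))) ⟩
  (1 + 2 * (9 * repunit₉ k)) % 2  ≡⟨ [1+2*n]%2≡1 (9 * repunit₉ k) ⟩
  1                               ≡⟨ [1+2*n]%2≡1 k ⟨
  (1 + 2 * k) % 2                 ∎
  where
  open ≡-Reasoning
  lemma : ∀ r → 1 + 18 * r ≡ 1 + 2 * (9 * r)
  lemma = solve-∀

v[i+2*k] : ∀ i k → v (i + 2 * k) ≡ v i + 2 * (repunit₉ k * 3 ^ suc i)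
v[i+2*k] i k with parity i
... | even s = begin
  v (2 * s + 2 * k)                                    ≡⟨ cong v (*-distribˡ-+ 2 s k) ⟨
  v (2 * (s + k))                                      ≡⟨ v[2*k] (s + k) ⟩
  2 + 6 * repunit₉ (s + k)                             ≡⟨ cong (λ x → 2 + 6 * x) (repunit₉-+ s k) ⟩
  2 + 6 * (repunit₉ s + 9 ^ s * repunit₉ k)            ≡⟨ lemma (repunit₉ s) (9 ^ s) (repunit₉ k) ⟩
  2 + 6 * repunit₉ s + 2 * (repunit₉ k * (3 * 9 ^ s))  ≡⟨ cong₂ (λ a b → a + 2 * (repunit₉ k * (3 * b)))
                                                                (v[2*k] s) (sym (^-*-assoc 3 2 s)) ⟨
  v (2 * s) + 2 * (repunit₉ k * 3 ^ suc (2 * s))       ∎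
  where
  open ≡-Reasoning
  lemma : ∀ a p b → 2 + 6 * (a + p * b) ≡ 2 + 6 * a + 2 * (b * (3 * p))
  lemma = solve-∀
... | odd s = begin
  v (1 + 2 * s + 2 * k)                                       ≡⟨ cong (v ∘ suc) (*-distribˡ-+ 2 s k) ⟨
  v (1 + 2 * (s + k))                                         ≡⟨ v[1+2*k] (s + k) ⟩
  1 + 18 * repunit₉ (s + k)                                   ≡⟨ cong (λ x → 1 + 18 * x) (repunit₉-+ s k) ⟩
  1 + 18 * (repunit₉ s + 9 ^ s * repunit₉ k)                  ≡⟨ lemma (repunit₉ s) (9 ^ s) (repunit₉ k) ⟩
  1 + 18 * repunit₉ s + 2 * (repunit₉ k * (3 * (3 * 9 ^ s)))  ≡⟨ cong₂ (λ a b → a + 2 * (repunit₉ k * (3 * (3 * b))))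
                                                                       (v[1+2*k] s) (sym (^-*-assoc 3 2 s)) ⟨
  v (1 + 2 * s) + 2 * (repunit₉ k * 3 ^ suc (1 + 2 * s))      ∎
  where
  open ≡-Reasoning
  lemma : ∀ a p b → 1 + 18 * (a + p * b) ≡ 1 + 18 * a + 2 * (b * (3 * (3 * p)))
  lemma = solve-∀

DifferenceShape : ℕ → ℕ → Set
DifferenceShape i j =
  v i % 2 ≢ v j % 2 ⊎
  ∃[ k ] ∣ i - j ∣ ≡ 2 * k × ∣ v i - v j ∣ ≡ 2 * (repunit₉ k * 3 ^ suc (i ⊓ j))

difference-shape-sym : ∀ {i j} → DifferenceShape i j → DifferenceShape j i
difference-shape-sym (inj₁ v%2≢)                     = inj₁ (v%2≢ ∘ sym)
difference-shape-sym {i} {j} (inj₂ (k , gap , diff)) = inj₂ (k , trans (∣-∣-comm j i) gap , (begin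
  ∣ v j - v i ∣                       ≡⟨ ∣-∣-comm (v j) (v i) ⟩
  ∣ v i - v j ∣                       ≡⟨ diff ⟩
  2 * (repunit₉ k * 3 ^ suc (i ⊓ j))  ≡⟨ cong (λ t → 2 * (repunit₉ k * 3 ^ suc t)) (⊓-comm i j) ⟩
  2 * (repunit₉ k * 3 ^ suc (j ⊓ i))  ∎))
  where open ≡-Reasoning

difference-shape-+ : ∀ i d → DifferenceShape i (i + d)
difference-shape-+ i d with parity d
... | even k = inj₂ (k , ∣m-m+n∣≡n i (2 * k) , (begin
  ∣ v i - v (i + 2 * k) ∣                        ≡⟨ cong (∣ v i -_∣) (v[i+2*k] i k) ⟩
  ∣ v i - v i + 2 * (repunit₉ k * 3 ^ suc i) ∣   ≡⟨ ∣m-m+n∣≡n (v i) _ ⟩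
  2 * (repunit₉ k * 3 ^ suc i)                   ≡⟨ cong (λ t → 2 * (repunit₉ k * 3 ^ suc t))
                                                         (m≤n⇒m⊓n≡m (m≤m+n i (2 * k))) ⟨
  2 * (repunit₉ k * 3 ^ suc (i ⊓ (i + 2 * k)))   ∎))
  where open ≡-Reasoning
... | odd k = inj₁ (λ v%2≡ → n%2≢[1+n]%2 i (begin
  i % 2                    ≡⟨ v%2≡%2 i ⟨
  v i % 2                  ≡⟨ v%2≡ ⟩
  v (i + suc (2 * k)) % 2  ≡⟨ v%2≡%2 (i + suc (2 * k)) ⟩
  (i + suc (2 * k)) % 2    ≡⟨ cong (_% 2) (trans (+-suc i (2 * k)) (cong (suc i +_) (*-comm 2 k))) ⟩
  (suc i + k * 2) % 2      ≡⟨ [m+kn]%n≡m%n (suc i) k 2 ⟩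
  suc i % 2                ∎))
  where open ≡-Reasoning

difference-shape : ∀ i j → DifferenceShape i j
difference-shape = wlog ≤-total difference-shape-sym
  (λ i j i≤j → subst (DifferenceShape i) (m+[n∸m]≡n i≤j) (difference-shape-+ i (j ∸ i)))

2^e∣∣v-v∣⇒2^e∣∣i-j∣ : ∀ e i j → 2 ^ e ∣ ∣ v i - v j ∣ → 2 ^ e ∣ ∣ i - j ∣
2^e∣∣v-v∣⇒2^e∣∣i-j∣ zero    i j _ = 1∣ ∣ i - j ∣
2^e∣∣v-v∣⇒2^e∣∣i-j∣ (suc e) i j 2^[1+e]∣ with difference-shape i j
... | inj₁ v%2≢ = contradiction (∣∣-∣⇒%≡% 2 {v i} {v j} (∣-trans (m∣m*n (2 ^ e)) 2^[1+e]∣)) v%2≢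
... | inj₂ (k , gap , diff) = subst (2 ^ suc e ∣_) (sym gap) (*-monoʳ-∣ 2 (2^e∣repunit₉⇒2^e∣ e k 2^e∣repunit₉))
  where
  2^e∣repunit₉ : 2 ^ e ∣ repunit₉ k
  2^e∣repunit₉ = p^e∣m*n∧p∤n⇒p^e∣m e prime[2]
    (*-cancelˡ-∣ 2 (subst (2 ^ suc e ∣_) diff 2^[1+e]∣)) (2∤3^n (suc (i ⊓ j)))

same-parity⇒3^⊓∣ : ∀ i j → v i % 2 ≡ v j % 2 → 3 ^ suc (i ⊓ j) ∣ ∣ v i - v j ∣
same-parity⇒3^⊓∣ i j v%2≡ with difference-shape i j
... | inj₁ v%2≢           = contradiction v%2≡ v%2≢
... | inj₂ (k , _ , diff) = subst (3 ^ suc (i ⊓ j) ∣_) (sym diff) (∣-trans (n∣m*n (repunit₉ k)) (n∣m*n 2))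

2^e-separated : ∀ {n} e → n ≤ 2 ^ e → Separated v n (2 ^ e)
2^e-separated e n≤2^e i j i<n j<n i≢j 2^e∣ =
  i≢j (∣∣m-n∣⇒≡ ∣i-j∣<2^e (2^e∣∣v-v∣⇒2^e∣∣i-j∣ e i j 2^e∣))
  where
  ∣i-j∣<2^e : ∣ i - j ∣ < 2 ^ e
  ∣i-j∣<2^e = ≤-trans (s≤s (∣m-n∣≤m⊔n i j)) (≤-trans (⊔-lub i<n j<n) n≤2^e)

separated-*3⇒separated-2* : ∀ {n K} → 3 ∤ K → Separated v n (K * 3) → Separated v n (2 * K)
separated-*3⇒separated-2* {K = K} 3∤K separated i j i<n j<n i≢j 2K∣ =
  separated i j i<n j<n i≢j (p∤k∧k∣m∧p∣m⇒k*p∣m prime[3] 3∤K (∣-trans (n∣m*n 2) 2K∣) 3∣)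
  where
  3∣ : 3 ∣ ∣ v i - v j ∣
  3∣ = ∣-trans (m∣m*n (3 ^ (i ⊓ j)))
         (same-parity⇒3^⊓∣ i j (∣∣-∣⇒%≡% 2 {v i} {v j} (∣-trans (m∣m*n K) 2K∣)))

separated-*9-length-bound : ∀ {n} Q .{{_ : NonZero Q}} → Separated v n (Q * 9) → n ≤ 1 + 2 * Q
separated-*9-length-bound {n} Q separated = separated-length-bound {v} {n} 1 (2 * Q) class collide separated
  where
  instance
    Q*9≢0 : NonZero (Q * 9)
    Q*9≢0 = m*n≢0 Q 9

  parity-bit< : ∀ i → v i % 2 < 2
  parity-bit< i = m%n<n (v i) 2

  quotient< : ∀ i → v i % (Q * 9) / 9 < Q
  quotient< i = m<n*o⇒m/o<n (m%n<n (v i) (Q * 9))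

  class : ℕ → Fin (2 * Q)
  class i = combine (fromℕ< (parity-bit< i)) (fromℕ< (quotient< i))

  collide : ∀ i j → 1 ≤ i → 1 ≤ j → class i ≡ class j → Q * 9 ∣ ∣ v i - v j ∣
  collide i@(suc i′) j@(suc j′) _ _ ci≡cj = %≡%⇒∣∣-∣ (Q * 9) (%≡%∧/≡/⇒≡ 9 (begin
    v i % (Q * 9) % 9  ≡⟨ m∣n⇒o%n%m≡o%m 9 (Q * 9) (v i) (n∣m*n Q) ⟩
    v i % 9            ≡⟨ ∣∣-∣⇒%≡% 9 {v i} {v j} (∣-trans (9∣3^[2+n] (i′ ⊓ j′)) (same-parity⇒3^⊓∣ i j same-parity)) ⟩
    v j % 9            ≡⟨ m∣n⇒o%n%m≡o%m 9 (Q * 9) (v j) (n∣m*n Q) ⟨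
    v j % (Q * 9) % 9  ∎) same-quotient)
    where
    open ≡-Reasoning
    same-components : fromℕ< (parity-bit< i) ≡ fromℕ< (parity-bit< j) × fromℕ< (quotient< i) ≡ fromℕ< (quotient< j)
    same-components = combine-injective (fromℕ< (parity-bit< i)) (fromℕ< (quotient< i))
                                        (fromℕ< (parity-bit< j)) (fromℕ< (quotient< j)) ci≡cj
    same-parity : v i % 2 ≡ v j % 2
    same-parity = fromℕ<-injective _ _ (parity-bit< i) (parity-bit< j) (proj₁ same-components)
    same-quotient : v i % (Q * 9) / 9 ≡ v j % (Q * 9) / 9
    same-quotient = fromℕ<-injective _ _ (quotient< i) (quotient< j) (proj₂ same-components)

1≤m*3⇒1≤m : ∀ {m} → 1 ≤ m * 3 → 1 ≤ m
1≤m*3⇒1≤m {suc m} _ = s≤s z≤n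

2*m<m*3 : ∀ {m} → 1 ≤ m → 2 * m < m * 3
2*m<m*3 {suc m} _ = subst (2 * suc m <_) (sym (lemma m)) (m≤m+n (suc (2 * suc m)) m)
  where
  lemma : ∀ m → suc m * 3 ≡ suc (2 * suc m) + m
  lemma = solve-∀

2*[1+2*m]≤m*3*3 : ∀ {m} → 1 ≤ m → 2 * (1 + 2 * m) ≤ m * 3 * 3
2*[1+2*m]≤m*3*3 {suc m} _ = subst (2 * (1 + 2 * suc m) ≤_) (sym (lemma m)) (m≤m+n (2 * (1 + 2 * suc m)) (5 * m + 3))
  where
  lemma : ∀ m → suc m * 3 * 3 ≡ 2 * (1 + 2 * suc m) + (5 * m + 3)
  lemma = solve-∀

smaller-separating-modulus : ∀ {n m} → 1 ≤ n → 1 ≤ m → 3 ∣ m → Separated v n m →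
                             ∃[ k ] 1 ≤ k × k < m × Separated v n k
smaller-separating-modulus 1≤n 1≤m (divides K refl) separated with 3 ∣? K
... | no 3∤K =
  let 1≤K = 1≤m*3⇒1≤m 1≤m
  in 2 * K , ≤-trans 1≤K (m≤n*m K 2) , 2*m<m*3 1≤K , separated-*3⇒separated-2* 3∤K separated
smaller-separating-modulus {suc n} 1≤n 1≤m (divides _ refl) separated | yes (divides Q refl) =
  let e , n≤2^e , 2^e<2*n = 2^-between n
  in 2 ^ e , ≤-trans 1≤n n≤2^e , <-≤-trans 2^e<2*n 2*n≤Q*3*3 , 2^e-separated e n≤2^e
  where
  1≤Q : 1 ≤ Q
  1≤Q = 1≤m*3⇒1≤m (1≤m*3⇒1≤m 1≤m)
  instance
    Q≢0 : NonZero Q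
    Q≢0 = >-nonZero 1≤Q
  n≤1+2*Q : suc n ≤ 1 + 2 * Q
  n≤1+2*Q = separated-*9-length-bound Q (subst (Separated v (suc n)) (*-assoc Q 3 3) separated)
  2*n≤Q*3*3 : 2 * suc n ≤ Q * 3 * 3
  2*n≤Q*3*3 = ≤-trans (*-monoʳ-≤ 2 n≤1+2*Q) (2*[1+2*m]≤m*3*3 1≤Q)

lemma11 : ∀ (n m : ℕ) → 1 ≤ n → IsDS n m → ¬ (3 ∣ m)
lemma11 n m 1≤n ((1≤m , incongruent) , minimal) 3∣m
  with smaller-separating-modulus 1≤n 1≤m 3∣m (incongruent⇒separated incongruent)
... | k , 1≤k , k<m , separated = minimal k 1≤k k<m (separated⇒incongruent separated)
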